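{- In the setting below, $H^1(X,\mathcal O_X)$ is generated as an $A$-module by the classes $[x^iy^{j-M}]$ with $i\in\{1,\dots,N-1\}$, $j\in\{1,\dots,M-1\}$. Moreover, for such $i,j$ and any integers $k,l$, there is an element $\alpha\in A$ such that $[x^{i+kN}y^{j+lM}]=\alpha\,[x^iy^{j-M}]$ in $H^1(X,\mathcal O_X)$.
   Context: Let $N,M\geq2$ be integers and $W$ a commutative ring in which $NM$ is invertible and which contains a primitive $\mathrm{lcm}(N,M)$-th root of unity. Let $A=W[t,(t-t^2)^{ -1}]$. Let $X\subset\mathbb P^1_A\times\mathbb P^1_A$ (coordinates $(X_0:X_1)$, $(Y_0:Y_1)$) be defined by $(X_0^N-X_1^N)(Y_0^M-Y_1^M)=tX_0^NY_0^M$, $x=X_1/X_0$, $y=Y_1/Y_0$, $z=x^{ -1}$, $w=y^{ -1}$, with affine cover $U_0=\{X_0Y_0\ne0\}=\operatorname{Spec}A[x,y]/((1-x^N)(1-y^M)-t)$, $U_1=\{X_1Y_1\ne0\}=\operatorname{Spec}A[z,w]/((1-z^N)(1-w^M)-tz^Nw^M)$. $H^1(X,\mathcal O_X)$ is identified with the cokernel of the Čech map $\Gamma(U_0,\mathcal O_X)\oplus\Gamma(U_1,\mathcal O_X)\to\Gamma(U_0\cap U_1,\mathcal O_X)$, $(u_0,u_1)\mapsto u_1-u_0$, and $[f]$ denotes the class of $f\in\Gamma(U_0\cap U_1,\mathcal O_X)$. -}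

module Defs where

open import Level using (_⊔_)
open import Algebra.Bundles using (CommutativeRing)
open import Data.Nat as ℕ using (ℕ; zero; suc)
open import Data.Integer as ℤ using (ℤ; +_)
open import Data.Product using (Σ; _×_; _,_; ∃)
open import Data.List using (List; []; _∷_; _++_; map; concatMap; concat)
open import Data.List.Relation.Unary.All using (All)
open import Data.Fin using (Fin; toℕ)
open import Data.List using (allFin)
open import Relation.Nullary using (¬_; does)
open import Data.Bool using (if_then_else_; _∧_)

module _ {c ℓ} (W : CommutativeRing c ℓ) where
  open CommutativeRing W

  natCast : ℕ → Carrier
  natCast zero    = 0#
  natCast (suc n) = 1# + natCast n

  pow : Carrier → ℕ → Carrier
  pow a zero    = 1#
  pow a (suc n) = a * pow a n

  NMInvertible : ℕ → ℕ → Set (c ⊔ ℓ)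
  NMInvertible N M = ∃ λ v → (v * (natCast N * natCast M)) ≈ 1#

  IsPrimitiveRoot : ℕ → Carrier → Set ℓ
  IsPrimitiveRoot L ζ = (pow ζ L ≈ 1#) × (∀ d → 0 ℕ.< d → d ℕ.< L → ¬ (pow ζ d ≈ 1#))

  HasPrimitiveRoot : ℕ → Set (c ⊔ ℓ)
  HasPrimitiveRoot L = ∃ λ ζ → IsPrimitiveRoot L ζ

  -- The ring W[t,u,x^{±1},y^{±1}], elements as finite formal sums of terms
  --   coeff · t^et · u^eu · x^ex · y^ey
  -- (u plays the role of (t - t^2)^{-1}; see Rloc below).
  record Term : Set c where
    constructor term
    field
      coeff : Carrier
      et eu : ℕ
      ex ey : ℤ
  open Term public

  Poly : Set c
  Poly = List Term

  coeffAt : Poly → ℕ → ℕ → ℤ → ℤ → Carrier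
  coeffAt [] a b i j = 0#
  coeffAt (term r a' b' i' j' ∷ p) a b i j =
    (if does (a ℕ.≟ a') ∧ does (b ℕ.≟ b') ∧ does (i ℤ.≟ i') ∧ does (j ℤ.≟ j')
       then r else 0#) + coeffAt p a b i j

  _⊕_ : Poly → Poly → Poly
  p ⊕ q = p ++ q

  ⊝_ : Poly → Poly
  ⊝ p = map (λ { (term r a b i j) → term (- r) a b i j }) p

  _⊖_ : Poly → Poly → Poly
  p ⊖ q = p ⊕ (⊝ q)

  termMul : Term → Term → Term
  termMul (term r a b i j) (term r' a' b' i' j') =
    term (r * r') (a ℕ.+ a') (b ℕ.+ b') (i ℤ.+ i') (j ℤ.+ j')

  _⊗_ : Poly → Poly → Poly
  p ⊗ q = concatMap (λ s → map (termMul s) q) p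

  _≋_ : Poly → Poly → Set ℓ
  p ≋ q = ∀ a b i j → coeffAt (p ⊖ q) a b i j ≈ 0#

  monoXY : ℤ → ℤ → Poly
  monoXY i j = term 1# 0 0 i j ∷ []

  -- the relation u (t - t^2) - 1 defining A = W[t, (t-t^2)^{-1}] = W[t,u]/(u(t-t^2)-1)
  Rloc : Poly
  Rloc = term 1# 1 1 (+ 0) (+ 0) ∷ term (- 1#) 2 1 (+ 0) (+ 0) ∷ term (- 1#) 0 0 (+ 0) (+ 0) ∷ []

  -- the equation of U_0: (1 - x^N)(1 - y^M) - t
  Feq : ℕ → ℕ → Poly
  Feq N M = term 1# 0 0 (+ 0) (+ 0) ∷ term (- 1#) 0 0 (+ N) (+ 0) ∷ term (- 1#) 0 0 (+ 0) (+ M)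
          ∷ term 1# 0 0 (+ N) (+ M) ∷ term (- 1#) 1 0 (+ 0) (+ 0) ∷ []

  InA : Poly → Set c
  InA p = All (λ s → (ex s ≡ℤ + 0) × (ey s ≡ℤ + 0)) p
    where open import Relation.Binary.PropositionalEquality renaming (_≡_ to _≡ℤ_)

  -- image of Γ(U_0) = A[x,y]/(F): only nonnegative x,y exponents
  InU0 : Poly → Set c
  InU0 p = All (λ s → (+ 0 ℤ.≤ ex s) × (+ 0 ℤ.≤ ey s)) p

  -- image of Γ(U_1) = A[z,w]/(..), z = x^{-1}, w = y^{-1}: only nonpositive x,y exponents
  InU1 : Poly → Set c
  InU1 p = All (λ s → (ex s ℤ.≤ + 0) × (ey s ℤ.≤ + 0)) p

  -- f represents 0 in H^1(X, O_X) = Γ(U_0∩U_1)/(im Γ(U_0) + im Γ(U_1)),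
  -- where Γ(U_0∩U_1) = W[t,u,x^{±1},y^{±1}]/(Rloc, F)
  H1Zero : ℕ → ℕ → Poly → Set (c ⊔ ℓ)
  H1Zero N M f = Σ Poly λ u0 → Σ Poly λ u1 → Σ Poly λ g → Σ Poly λ h →
    InU0 u0 × InU1 u1 × (f ≋ ((u1 ⊖ u0) ⊕ ((g ⊗ Feq N M) ⊕ (h ⊗ Rloc))))

  H1Eq : ℕ → ℕ → Poly → Poly → Set (c ⊔ ℓ)
  H1Eq N M f g = H1Zero N M (f ⊖ g)

  -- generator x^i y^{j-M} indexed by i ∈ {1..N-1}, j ∈ {1..M-1} (via Fin (N-1), Fin (M-1))
  gen : (N M : ℕ) → Fin (N ℕ.∸ 1) → Fin (M ℕ.∸ 1) → Poly
  gen N M i j = monoXY (+ suc (toℕ i)) (+ suc (toℕ j) ℤ.- + M)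

  genCombination : (N M : ℕ) → (Fin (N ℕ.∸ 1) → Fin (M ℕ.∸ 1) → Poly) → Poly
  genCombination N M α =
    concat (map (λ i → concat (map (λ j → α i j ⊗ gen N M i j) (allFin (M ℕ.∸ 1))))
                (allFin (N ℕ.∸ 1)))

{-# OPTIONS --safe #-}
module Submission where

-- On U₀ ∩ U₁ we have (1 - x^N)(1 - y^M) = t, so for every exponent (X, Y)
--   x^X y^Y - x^(X+N) y^Y - x^X y^(Y+M) + x^(X+N) y^(Y+M) = t x^X y^Y,
-- and in H¹ the class of the monomial at any corner of an N × M box of exponents is an
-- A-linear combination of the classes at the other three corners. Monomials with both
-- exponents ≥ 0 come from Γ(U₀) and those with both exponents ≤ 0 from Γ(U₁), so their
-- classes vanish. Fix residues 0 ≤ i < N, 0 ≤ j < M; starting from x^i y^(j-M) and filling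
-- the two remaining quadrants of the lattice (i + kN, j + lM) box by box from the vanishing
-- ones, every [x^(i+kN) y^(j+lM)] is an A-multiple of [x^i y^(j-M)]. When i = 0 or j = 0 the
-- sweep starts from a vanishing monomial, so all these classes are 0. Every element of
-- Γ(U₀ ∩ U₁) is a sum of monomials, which gives the first statement.

open import Level using (_⊔_)
open import Algebra.Bundles using (CommutativeRing; CommutativeMonoid; AbelianGroup)
open import Algebra.Structures using (IsAbelianGroup)
open import Data.Bool using (true; false; if_then_else_; _∧_)
open import Data.Fin as Fin using (Fin)
import Data.Fin.Properties as Fin
open import Data.Nat as ℕ using (ℕ; zero; suc)
import Data.Nat.Properties as ℕ
open import Data.Integer as ℤ using (ℤ; +_; -[1+_])
import Data.Integer.Properties as ℤ
import Data.Integer.DivMod as ℤ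
open import Data.List using ([]; _∷_; _++_; map; concat; tabulate; allFin)
import Data.List.Properties as List
open import Data.List.Relation.Binary.Pointwise using (Pointwise; []; _∷_)
open import Data.List.Relation.Unary.All using (All; []; _∷_)
import Data.List.Relation.Unary.All.Properties as All
open import Data.Product using (Σ; _×_; _,_)
open import Data.Vec.Functional using (Vector)
open import Function using (id; _∘_)
open import Relation.Nullary using (does)
open import Relation.Nullary.Decidable using (dec-true; dec-false)
open import Relation.Binary.PropositionalEquality as ≡ using (_≡_; _≢_)
open import Defs hiding (_⊕_)

module _ {c ℓ} (G : CommutativeMonoid c ℓ) where
  open CommutativeMonoid G
  open import Algebra.Properties.CommutativeMonoid.Sum G

  sum-single : ∀ {n} (t : Vector Carrier n) i → (∀ k → k ≢ i → t k ≈ ε) → sum t ≈ t i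
  sum-single {suc n} t i vanishes = begin
    sum t                   ≈⟨ sum-remove t ⟩
    t i ∙ sum (t ∘ punchIn) ≈⟨ ∙-congˡ (sum-cong-≋ {n} (λ k → vanishes _ (Fin.punchInᵢ≢i i k))) ⟩
    t i ∙ sum {n} (λ _ → ε) ≈⟨ ∙-congˡ (sum-replicate-zero n) ⟩
    t i ∙ ε                 ≈⟨ identityʳ (t i) ⟩
    t i                     ∎
    where
    open import Relation.Binary.Reasoning.Setoid setoid
    punchIn = Fin.punchIn i

module Affine where
  open import Data.Integer.Solver using (module +-*-Solver)
  open +-*-Solver

  affine : ℕ → ℕ → ℤ → ℤ
  affine n i k = + i ℤ.+ k ℤ.* + n

  affine-suc : ∀ n i k → affine n i (ℤ.suc k) ≡ affine n i k ℤ.+ + n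
  affine-suc n i k = solve 3 (λ i k n → i :+ (con (+ 1) :+ k) :* n := (i :+ k :* n) :+ n) ≡.refl (+ i) k (+ n)

  affine-zero : ∀ n i → affine n i (+ 0) ≡ + i
  affine-zero n i = ℤ.+-identityʳ (+ i)

  affine-minus-one : ∀ n i → affine n i -[1+ 0 ] ≡ + i ℤ.- + n
  affine-minus-one n i = ≡.cong (ℤ._+_ (+ i)) (ℤ.-1*i≡-i (+ n))

  affine-residue-zero : ∀ n l → affine n 0 l ≡ affine n n (l ℤ.- + 1)
  affine-residue-zero n l = solve 2 (λ l n → con (+ 0) :+ l :* n := n :+ (l :- con (+ 1)) :* n) ≡.refl l (+ n)

  0≤affine : ∀ n i m → + 0 ℤ.≤ affine n i (+ m)
  0≤affine n i m = ≡.subst (λ z → + 0 ℤ.≤ + i ℤ.+ z) (ℤ.pos-* m n) (ℤ.+≤+ ℕ.z≤n)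

  affine≤0 : ∀ {n i} m → i ℕ.≤ n → affine n i -[1+ m ] ℤ.≤ + 0
  affine≤0 {n} {i} m i≤n =
    ≡.subst (ℤ._≤ + 0) (≡.sym affine≡) (ℤ.i≤j⇒i-j≤0 (ℤ.+≤+ (ℕ.≤-trans i≤n (ℕ.m≤m+n n _))))
    where
    affine≡ : affine n i -[1+ m ] ≡ + i ℤ.- + (n ℕ.+ m ℕ.* n)
    affine≡ = ≡.cong (ℤ._+_ (+ i))
      (≡.trans (≡.sym (ℤ.neg-distribˡ-* (+ suc m) (+ n))) (≡.cong ℤ.-_ (≡.sym (ℤ.pos-* (suc m) n))))

open Affine

module Polynomials {c ℓ} (W : CommutativeRing c ℓ) where
  open CommutativeRing W
  open import Algebra.Properties.Ring ring using (-0#≈0#; -‿+-comm; -‿distribˡ-*)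

  infix 4 _≐_ _≈ₜ_
  infixl 6 _⊖ₚ_
  infixl 7 _⊗ₚ_
  infix 8 ⊝ₚ_

  ⊝ₚ_ : Poly W → Poly W
  ⊝ₚ_ = ⊝_ W

  _⊖ₚ_ _⊗ₚ_ : Poly W → Poly W → Poly W
  _⊖ₚ_ = _⊖_ W
  _⊗ₚ_ = _⊗_ W

  record _≐_ (p q : Poly W) : Set ℓ where
    constructor mk≐
    field coeffAt-≈ : ∀ a b i j → coeffAt W p a b i j ≈ coeffAt W q a b i j
  open _≐_ public

  coeffAt-++ : ∀ p q a b i j → coeffAt W (p ++ q) a b i j ≈ coeffAt W p a b i j + coeffAt W q a b i j
  coeffAt-++ []                   q a b i j = sym (+-identityˡ _)
  coeffAt-++ (term _ _ _ _ _ ∷ p) q a b i j = trans (+-congˡ (coeffAt-++ p q a b i j)) (sym (+-assoc _ _ _))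

  coeffAt-⊝ : ∀ p a b i j → coeffAt W (⊝ₚ p) a b i j ≈ - coeffAt W p a b i j
  coeffAt-⊝ []                   a b i j = sym -0#≈0#
  coeffAt-⊝ (term r _ _ _ _ ∷ p) a b i j = trans (+-cong (negate-if _) (coeffAt-⊝ p a b i j)) (-‿+-comm _ _)
    where
    negate-if : ∀ b → (if b then - r else 0#) ≈ - (if b then r else 0#)
    negate-if true  = refl
    negate-if false = sym -0#≈0#

  ≡⇒≐ : ∀ {p q} → p ≡ q → p ≐ q
  ≡⇒≐ ≡.refl = mk≐ λ _ _ _ _ → refl

  isAbelianGroup : IsAbelianGroup _≐_ _++_ [] ⊝ₚ_
  isAbelianGroup = record
    { isGroup = record
      { isMonoid = record
        { isSemigroup = record
          { isMagma = record
            { isEquivalence = record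
              { refl  = mk≐ λ _ _ _ _ → refl
              ; sym   = λ p≐q → mk≐ λ a b i j → sym (coeffAt-≈ p≐q a b i j)
              ; trans = λ p≐q q≐r → mk≐ λ a b i j → trans (coeffAt-≈ p≐q a b i j) (coeffAt-≈ q≐r a b i j)
              }
            ; ∙-cong = λ {p} {p′} {q} {q′} p≐p′ q≐q′ → mk≐ λ a b i j → begin
                coeffAt W (p ++ q) a b i j                  ≈⟨ coeffAt-++ p q a b i j ⟩
                coeffAt W p a b i j + coeffAt W q a b i j   ≈⟨ +-cong (coeffAt-≈ p≐p′ a b i j) (coeffAt-≈ q≐q′ a b i j) ⟩
                coeffAt W p′ a b i j + coeffAt W q′ a b i j ≈⟨ coeffAt-++ p′ q′ a b i j ⟨
                coeffAt W (p′ ++ q′) a b i j                ∎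
            }
          ; assoc = λ p q r → ≡⇒≐ (List.++-assoc p q r)
          }
        ; identity = (λ _ → mk≐ λ _ _ _ _ → refl) , (λ p → ≡⇒≐ (List.++-identityʳ p))
        }
      ; inverse = (λ p → mk≐ λ a b i j →
                    trans (coeffAt-++ (⊝ₚ p) p a b i j) (trans (+-congʳ (coeffAt-⊝ p a b i j)) (-‿inverseˡ _)))
                , (λ p → mk≐ λ a b i j →
                    trans (coeffAt-++ p (⊝ₚ p) a b i j) (trans (+-congˡ (coeffAt-⊝ p a b i j)) (-‿inverseʳ _)))
      ; ⁻¹-cong = λ {p} {q} p≐q → mk≐ λ a b i j →
          trans (coeffAt-⊝ p a b i j) (trans (-‿cong (coeffAt-≈ p≐q a b i j)) (sym (coeffAt-⊝ q a b i j)))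
      }
    ; comm = λ p q → mk≐ λ a b i j →
        trans (coeffAt-++ p q a b i j) (trans (+-comm _ _) (sym (coeffAt-++ q p a b i j)))
    }
    where open import Relation.Binary.Reasoning.Setoid setoid

  polynomialGroup : AbelianGroup c ℓ
  polynomialGroup = record { isAbelianGroup = isAbelianGroup }

  module P = AbelianGroup polynomialGroup
  open import Algebra.Properties.CommutativeMonoid.Sum P.commutativeMonoid using (sum)

  data _≈ₜ_ : Term W → Term W → Set (c ⊔ ℓ) where
    term-≈ : ∀ {r r′ a a′ b b′ i i′ j j′} → r ≈ r′ → a ≡ a′ → b ≡ b′ → i ≡ i′ → j ≡ j′ →
             term r a b i j ≈ₜ term r′ a′ b′ i′ j′

  Pointwise⇒≐ : ∀ {p q} → Pointwise _≈ₜ_ p q → p ≐ q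
  Pointwise⇒≐ [] = mk≐ λ _ _ _ _ → refl
  Pointwise⇒≐ (term-≈ r≈r′ ≡.refl ≡.refl ≡.refl ≡.refl ∷ p≈q) =
    mk≐ λ a b i j → +-cong (if-cong _ r≈r′) (coeffAt-≈ (Pointwise⇒≐ p≈q) a b i j)
    where
    if-cong : ∀ b {x y} → x ≈ y → (if b then x else 0#) ≈ (if b then y else 0#)
    if-cong true  x≈y = x≈y
    if-cong false _   = refl

  ⊝-++ : ∀ p q → ⊝ₚ (p ++ q) ≡ ⊝ₚ p ++ ⊝ₚ q
  ⊝-++ p q = List.map-++ _ p q

  ⊗-distribʳ-++ : ∀ p q r → (p ++ q) ⊗ₚ r ≡ p ⊗ₚ r ++ q ⊗ₚ r
  ⊗-distribʳ-++ p q r = ≡.trans (≡.cong concat (List.map-++ _ p q)) (≡.sym (List.concat-++ (map _ p) (map _ q)))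

  ⊝-⊗ : ∀ p q → (⊝ₚ p) ⊗ₚ q ≐ ⊝ₚ (p ⊗ₚ q)
  ⊝-⊗ []                     q = P.refl
  ⊝-⊗ (term r a b i j ∷ p) q = P.trans
      (P.∙-cong (Pointwise⇒≐ (negate-termMul q)) (⊝-⊗ p q))
      (≡⇒≐ (≡.sym (⊝-++ (map (termMul W (term r a b i j)) q) (p ⊗ₚ q))))
    where
    negate-termMul : ∀ q → Pointwise _≈ₜ_ (map (termMul W (term (- r) a b i j)) q)
                                          (⊝ₚ map (termMul W (term r a b i j)) q)
    negate-termMul []                   = []
    negate-termMul (term _ _ _ _ _ ∷ q) =
      term-≈ (sym (-‿distribˡ-* _ _)) ≡.refl ≡.refl ≡.refl ≡.refl ∷ negate-termMul q

  ⊖-interchange : ∀ p q r s → (p ++ q) ⊖ₚ (r ++ s) ≐ (p ⊖ₚ r) ++ (q ⊖ₚ s)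
  ⊖-interchange p q r s = P.trans (≡⇒≐ (≡.cong ((p ++ q) ++_) (⊝-++ r s)))
    (solve 4 (λ p q r s → (p ⊕ q) ⊕ (r ⊕ s) ⊜ (p ⊕ r) ⊕ (q ⊕ s)) P.refl p q (⊝ₚ r) (⊝ₚ s))
    where open import Algebra.Solver.CommutativeMonoid P.commutativeMonoid using (solve; _⊕_; _⊜_)

  ⊝-preserves-exponents : ∀ {h} {Q : ℤ → ℤ → Set h} {p} →
    All (λ s → Q (ex s) (ey s)) p → All (λ s → Q (ex s) (ey s)) (⊝ₚ p)
  ⊝-preserves-exponents {p = []}                   []       = []
  ⊝-preserves-exponents {p = term _ _ _ _ _ ∷ _} (q ∷ qs) = q ∷ ⊝-preserves-exponents qs

  concat-tabulate : ∀ n (f : Fin n → Poly W) → concat (tabulate f) ≡ sum f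
  concat-tabulate zero    f = ≡.refl
  concat-tabulate (suc n) f = ≡.cong (f Fin.zero ++_) (concat-tabulate n (λ i → f (Fin.suc i)))

  concat-map-allFin : ∀ n (f : Fin n → Poly W) → concat (map f (allFin n)) ≡ sum f
  concat-map-allFin n f = ≡.trans (≡.cong concat (List.map-tabulate id f)) (concat-tabulate n f)

  monomial : Carrier → ℕ → ℕ → ℤ → ℤ → Poly W
  monomial r a b x y = term r a b x y ∷ []

  record IsSubgroup {h} (H : Poly W → Set h) : Set (c ⊔ ℓ ⊔ h) where
    field
      ∈-resp-≐  : ∀ {p q} → p ≐ q → H p → H q
      []∈       : H []
      ++-closed : ∀ {p q} → H p → H q → H (p ++ q)
      ⊝-closed  : ∀ {p} → H p → H (⊝ₚ p)

    ∈-cancelʳ : ∀ {p q} → H (p ++ q) → H q → H p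
    ∈-cancelʳ {p} {q} p+q∈H q∈H = ∈-resp-≐
      (P.trans (P.assoc p q (⊝ₚ q)) (P.trans (P.∙-congˡ (P.inverseʳ q)) (P.identityʳ p)))
      (++-closed p+q∈H (⊝-closed q∈H))

    ⊝∈⇒∈ : ∀ {p} → H (⊝ₚ p) → H p
    ⊝∈⇒∈ {p} ⊝p∈H = ∈-resp-≐ (⁻¹-involutive p) (⊝-closed ⊝p∈H)
      where open import Algebra.Properties.Group P.group using (⁻¹-involutive)

module Cohomology {c ℓ} (W : CommutativeRing c ℓ) (N M : ℕ) where
  open CommutativeRing W
  open import Algebra.Properties.Ring ring using (-‿distribʳ-*)
  open Polynomials W
  open import Algebra.Properties.Group P.group using (x∙y⁻¹≈ε⇒x≈y; x≈y⇒x∙y⁻¹≈ε; ⁻¹-involutive)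
  open import Relation.Binary.Reasoning.Setoid P.setoid

  [_]≈0 : Poly W → Set (c ⊔ ℓ)
  [_]≈0 = H1Zero W N M

  [_]≈[_] : Poly W → Poly W → Set (c ⊔ ℓ)
  [_]≈[_] = H1Eq W N M

  F R : Poly W
  F = Feq W N M
  R = Rloc W

  nullForm : Poly W → Poly W → Poly W → Poly W → Poly W
  nullForm u0 u1 g h = (u1 ⊖ₚ u0) ++ (g ⊗ₚ F ++ h ⊗ₚ R)

  ≋⇒≐ : ∀ p q → _≋_ W p q → p ≐ q
  ≋⇒≐ p q p≋q = x∙y⁻¹≈ε⇒x≈y p q (mk≐ p≋q)

  ≐⇒≋ : ∀ p q → p ≐ q → _≋_ W p q
  ≐⇒≋ _ _ p≐q = coeffAt-≈ (x≈y⇒x∙y⁻¹≈ε p≐q)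

  nullForm-++ : ∀ u0 u1 g h u0′ u1′ g′ h′ →
    nullForm u0 u1 g h ++ nullForm u0′ u1′ g′ h′ ≐ nullForm (u0 ++ u0′) (u1 ++ u1′) (g ++ g′) (h ++ h′)
  nullForm-++ u0 u1 g h u0′ u1′ g′ h′ = begin
    ((u1 ++ ⊝ₚ u0) ++ (g ⊗ₚ F ++ h ⊗ₚ R)) ++ ((u1′ ++ ⊝ₚ u0′) ++ (g′ ⊗ₚ F ++ h′ ⊗ₚ R))
      ≈⟨ solve 8 (λ a b c d a′ b′ c′ d′ → ((a ⊕ b) ⊕ (c ⊕ d)) ⊕ ((a′ ⊕ b′) ⊕ (c′ ⊕ d′))
                                        ⊜ ((a ⊕ a′) ⊕ (b ⊕ b′)) ⊕ ((c ⊕ c′) ⊕ (d ⊕ d′)))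
               P.refl u1 (⊝ₚ u0) (g ⊗ₚ F) (h ⊗ₚ R) u1′ (⊝ₚ u0′) (g′ ⊗ₚ F) (h′ ⊗ₚ R) ⟩
    ((u1 ++ u1′) ++ (⊝ₚ u0 ++ ⊝ₚ u0′)) ++ ((g ⊗ₚ F ++ g′ ⊗ₚ F) ++ (h ⊗ₚ R ++ h′ ⊗ₚ R))
      ≡⟨ ≡.cong₂ _++_ (≡.cong ((u1 ++ u1′) ++_) (⊝-++ u0 u0′))
                      (≡.cong₂ _++_ (⊗-distribʳ-++ g g′ F) (⊗-distribʳ-++ h h′ R)) ⟨
    nullForm (u0 ++ u0′) (u1 ++ u1′) (g ++ g′) (h ++ h′) ∎
    where open import Algebra.Solver.CommutativeMonoid P.commutativeMonoid using (solve; _⊕_; _⊜_)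

  ⊝-nullForm : ∀ u0 u1 g h → ⊝ₚ nullForm u0 u1 g h ≐ nullForm (⊝ₚ u0) (⊝ₚ u1) (⊝ₚ g) (⊝ₚ h)
  ⊝-nullForm u0 u1 g h = begin
    ⊝ₚ nullForm u0 u1 g h
      ≡⟨ ≡.trans (⊝-++ (u1 ⊖ₚ u0) (g ⊗ₚ F ++ h ⊗ₚ R))
                 (≡.cong₂ _++_ (⊝-++ u1 (⊝ₚ u0)) (⊝-++ (g ⊗ₚ F) (h ⊗ₚ R))) ⟩
    (⊝ₚ u1 ++ ⊝ₚ ⊝ₚ u0) ++ (⊝ₚ (g ⊗ₚ F) ++ ⊝ₚ (h ⊗ₚ R))
      ≈⟨ P.∙-congˡ {⊝ₚ u1 ++ ⊝ₚ ⊝ₚ u0} (P.∙-cong (P.sym (⊝-⊗ g F)) (P.sym (⊝-⊗ h R))) ⟩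
    nullForm (⊝ₚ u0) (⊝ₚ u1) (⊝ₚ g) (⊝ₚ h) ∎

  [≈0]-resp : ∀ {p q} → p ≐ q → [ p ]≈0 → [ q ]≈0
  [≈0]-resp {p} p≐q (u0 , u1 , g , h , u0∈U0 , u1∈U1 , p≋) =
    u0 , u1 , g , h , u0∈U0 , u1∈U1 , ≐⇒≋ _ _ (P.trans (P.sym p≐q) (≋⇒≐ p (nullForm u0 u1 g h) p≋))

  [≈0]-++ : ∀ {p q} → [ p ]≈0 → [ q ]≈0 → [ p ++ q ]≈0
  [≈0]-++ {p} {q} (u0 , u1 , g , h , u0∈U0 , u1∈U1 , p≋) (u0′ , u1′ , g′ , h′ , u0′∈U0 , u1′∈U1 , q≋) =
    u0 ++ u0′ , u1 ++ u1′ , g ++ g′ , h ++ h′ , All.++⁺ u0∈U0 u0′∈U0 , All.++⁺ u1∈U1 u1′∈U1 ,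
    ≐⇒≋ _ _ (P.trans (P.∙-cong (≋⇒≐ p (nullForm u0 u1 g h) p≋) (≋⇒≐ q (nullForm u0′ u1′ g′ h′) q≋))
                     (nullForm-++ u0 u1 g h u0′ u1′ g′ h′))

  [≈0]-⊝ : ∀ {p} → [ p ]≈0 → [ ⊝ₚ p ]≈0
  [≈0]-⊝ {p} (u0 , u1 , g , h , u0∈U0 , u1∈U1 , p≋) =
    ⊝ₚ u0 , ⊝ₚ u1 , ⊝ₚ g , ⊝ₚ h , ⊝-preserves-exponents u0∈U0 , ⊝-preserves-exponents u1∈U1 ,
    ≐⇒≋ _ _ (P.trans (P.⁻¹-cong (≋⇒≐ p (nullForm u0 u1 g h) p≋)) (⊝-nullForm u0 u1 g h))

  [≈0]-isSubgroup : IsSubgroup [_]≈0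
  [≈0]-isSubgroup = record
    { ∈-resp-≐  = [≈0]-resp
    ; []∈       = [] , [] , [] , [] , [] , [] , λ _ _ _ _ → refl
    ; ++-closed = λ {p} {q} → [≈0]-++ {p} {q}
    ; ⊝-closed  = λ {p} → [≈0]-⊝ {p}
    }

  open IsSubgroup [≈0]-isSubgroup using () renaming ([]∈ to [[]]≈0)

  [⊗F]≈0 : ∀ g → [ g ⊗ₚ F ]≈0
  [⊗F]≈0 g = [] , [] , g , [] , [] , [] , ≐⇒≋ _ _ (P.sym (P.identityʳ (g ⊗ₚ F)))

  InU0⇒[≈0] : ∀ {u} → InU0 W u → [ u ]≈0
  InU0⇒[≈0] {u} u∈U0 = ⊝ₚ u , [] , [] , [] , ⊝-preserves-exponents u∈U0 , [] ,
    ≐⇒≋ _ _ (P.sym (P.trans (P.identityʳ (⊝ₚ ⊝ₚ u)) (⁻¹-involutive u)))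

  InU1⇒[≈0] : ∀ {u} → InU1 W u → [ u ]≈0
  InU1⇒[≈0] {u} u∈U1 = [] , u , [] , [] , [] , u∈U1 ,
    ≐⇒≋ _ _ (P.sym (P.trans (P.identityʳ (u ++ [])) (P.identityʳ u)))

  ≐⇒[≈] : ∀ {p q} → p ≐ q → [ p ]≈[ q ]
  ≐⇒[≈] p≐q = [≈0]-resp {[]} (P.sym (x≈y⇒x∙y⁻¹≈ε p≐q)) [[]]≈0

  [≈0]⇒[≈[]] : ∀ {p} → [ p ]≈0 → [ p ]≈[ [] ]
  [≈0]⇒[≈[]] {p} = [≈0]-resp (P.sym (P.identityʳ p))

  [≈]-resp : ∀ {p p′ q q′} → p ≐ p′ → q ≐ q′ → [ p ]≈[ q ] → [ p′ ]≈[ q′ ]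
  [≈]-resp {p} {q = q} p≐p′ q≐q′ = [≈0]-resp {p ⊖ₚ q} (P.∙-cong p≐p′ (P.⁻¹-cong q≐q′))

  [≈]-++ : ∀ {p q r s} → [ p ]≈[ r ] → [ q ]≈[ s ] → [ p ++ q ]≈[ r ++ s ]
  [≈]-++ {p} {q} {r} {s} p≈r q≈s = [≈0]-resp (P.sym (⊖-interchange p q r s)) ([≈0]-++ {p ⊖ₚ r} {q ⊖ₚ s} p≈r q≈s)

  [≈]-⊝ : ∀ {p q} → [ p ]≈[ q ] → [ ⊝ₚ p ]≈[ ⊝ₚ q ]
  [≈]-⊝ {p} {q} p≈q = [≈0]-resp (≡⇒≐ (⊝-++ p (⊝ₚ q))) ([≈0]-⊝ {p ⊖ₚ q} p≈q)

  infix 4 _∈A·[_]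
  _∈A·[_] : Poly W → Poly W → Set (c ⊔ ℓ)
  p ∈A·[ g ] = Σ (Poly W) λ α → InA W α × [ p ]≈[ α ⊗ₚ g ]

  ∈A·-resp : ∀ {g p q} → p ≐ q → p ∈A·[ g ] → q ∈A·[ g ]
  ∈A·-resp {g} {p} p≐q (α , α∈A , p≈αg) = α , α∈A , [≈]-resp {p} {q = α ⊗ₚ g} p≐q P.refl p≈αg

  ∈A·-++ : ∀ {g p q} → p ∈A·[ g ] → q ∈A·[ g ] → p ++ q ∈A·[ g ]
  ∈A·-++ {g} {p} {q} (α , α∈A , p≈αg) (β , β∈A , q≈βg) = α ++ β , All.++⁺ α∈A β∈A ,
    [≈]-resp {p ++ q} {q = α ⊗ₚ g ++ β ⊗ₚ g} P.refl (≡⇒≐ (≡.sym (⊗-distribʳ-++ α β g)))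
             ([≈]-++ {p} {q} {α ⊗ₚ g} {β ⊗ₚ g} p≈αg q≈βg)

  ∈A·-⊝ : ∀ {g p} → p ∈A·[ g ] → ⊝ₚ p ∈A·[ g ]
  ∈A·-⊝ {g} {p} (α , α∈A , p≈αg) = ⊝ₚ α , ⊝-preserves-exponents α∈A ,
    [≈]-resp {⊝ₚ p} {q = ⊝ₚ (α ⊗ₚ g)} P.refl (P.sym (⊝-⊗ α g)) ([≈]-⊝ {p} {α ⊗ₚ g} p≈αg)

  ∈A·-isSubgroup : ∀ g → IsSubgroup (_∈A·[ g ])
  ∈A·-isSubgroup g = record
    { ∈-resp-≐  = λ {p} {q} → ∈A·-resp {g} {p} {q}
    ; []∈       = [] , [] , ≐⇒[≈] {[]} {[]} P.refl
    ; ++-closed = λ {p} {q} → ∈A·-++ {g} {p} {q}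
    ; ⊝-closed  = λ {p} → ∈A·-⊝ {g} {p}
    }

  [≈0]⇒∈A· : ∀ {g p} → [ p ]≈0 → p ∈A·[ g ]
  [≈0]⇒∈A· {p = p} p≈0 = [] , [] , [≈0]⇒[≈[]] {p} p≈0

  monomial∈A·[monoXY] : ∀ r a b x y → monomial r a b x y ∈A·[ monoXY W x y ]
  monomial∈A·[monoXY] r a b x y = monomial r a b (+ 0) (+ 0) , (≡.refl , ≡.refl) ∷ [] ,
    ≐⇒[≈] (Pointwise⇒≐ (term-≈ (sym (*-identityʳ r)) (≡.sym (ℕ.+-identityʳ a)) (≡.sym (ℕ.+-identityʳ b))
                                (≡.sym (ℤ.+-identityˡ x)) (≡.sym (ℤ.+-identityˡ y)) ∷ []))

  monomial⊗F : ∀ r a b x y → monomial r a b x y ⊗ₚ F ≐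
    monomial r a b x y ++ ⊝ₚ monomial r a b (x ℤ.+ + N) y ++ ⊝ₚ monomial r a b x (y ℤ.+ + M) ++
    monomial r a b (x ℤ.+ + N) (y ℤ.+ + M) ++ ⊝ₚ monomial r (suc a) b x y
  monomial⊗F r a b x y = Pointwise⇒≐
    ( term-≈ (*-identityʳ r) a+0 b+0 (ℤ.+-identityʳ x) (ℤ.+-identityʳ y)
    ∷ term-≈ r·-1 a+0 b+0 ≡.refl (ℤ.+-identityʳ y)
    ∷ term-≈ r·-1 a+0 b+0 (ℤ.+-identityʳ x) ≡.refl
    ∷ term-≈ (*-identityʳ r) a+0 b+0 ≡.refl ≡.refl
    ∷ term-≈ r·-1 (ℕ.+-comm a 1) b+0 (ℤ.+-identityʳ x) (ℤ.+-identityʳ y)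
    ∷ [])
    where
    a+0 = ℕ.+-identityʳ a
    b+0 = ℕ.+-identityʳ b
    r·-1 : r * - 1# ≈ - r
    r·-1 = trans (sym (-‿distribʳ-* r 1#)) (-‿cong (*-identityʳ r))

  module Corners {h} {H : Poly W → Set h} (H-isSubgroup : IsSubgroup H) ([≈0]⊆H : ∀ {p} → [ p ]≈0 → H p) where
    open IsSubgroup H-isSubgroup
    open import Algebra.Properties.CommutativeSemigroup P.commutativeSemigroup using (x∙yz≈y∙xz)

    -- Quantifying over the coefficient and the t, u exponents lets the hypotheses also cover
    -- the negated terms and the term t x^X y^Y of the relation given by F.
    Monomials : ℤ → ℤ → Set (c ⊔ h)
    Monomials x y = ∀ r a b → H (monomial r a b x y)

    -- Moving the unknown corner to the front of monomial⊗F and cancelling the remaining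
    -- four terms, which lie in H, leaves its negative in H.
    corner₁₀ : ∀ {x x′ y y′} → x′ ≡ x ℤ.+ + N → y′ ≡ y ℤ.+ + M →
               Monomials x y → Monomials x y′ → Monomials x′ y′ → Monomials x′ y
    corner₁₀ {x} {_} {y} ≡.refl ≡.refl m₀₀ m₀₁ m₁₁ r a b =
      ⊝∈⇒∈ (∈-cancelʳ (∈-resp-≐ (x∙yz≈y∙xz e₀₀ (⊝ₚ e₁₀) _) relation) others)
      where
      e₀₀ = monomial r a b x y
      e₁₀ = monomial r a b (x ℤ.+ + N) y
      relation = ∈-resp-≐ (monomial⊗F r a b x y) ([≈0]⊆H ([⊗F]≈0 (monomial r a b x y)))
      others = ++-closed (m₀₀ r a b) (++-closed (m₀₁ (- r) a b) (++-closed (m₁₁ r a b) (m₀₀ (- r) (suc a) b)))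

    corner₀₁ : ∀ {x x′ y y′} → x′ ≡ x ℤ.+ + N → y′ ≡ y ℤ.+ + M →
               Monomials x y → Monomials x′ y → Monomials x′ y′ → Monomials x y′
    corner₀₁ {x} {_} {y} ≡.refl ≡.refl m₀₀ m₁₀ m₁₁ r a b =
      ⊝∈⇒∈ (∈-cancelʳ (∈-resp-≐ (P.trans (P.∙-congˡ {e₀₀} (x∙yz≈y∙xz (⊝ₚ e₁₀) (⊝ₚ e₀₁) _))
                                          (x∙yz≈y∙xz e₀₀ (⊝ₚ e₀₁) _)) relation) others)
      where
      e₀₀ = monomial r a b x y
      e₁₀ = monomial r a b (x ℤ.+ + N) y
      e₀₁ = monomial r a b x (y ℤ.+ + M)
      relation = ∈-resp-≐ (monomial⊗F r a b x y) ([≈0]⊆H ([⊗F]≈0 (monomial r a b x y)))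
      others = ++-closed (m₀₀ r a b) (++-closed (m₁₀ (- r) a b) (++-closed (m₁₁ r a b) (m₀₀ (- r) (suc a) b)))

    module Sweep {i₀ j₀} (i₀≤N : i₀ ℕ.≤ N) (j₀≤M : j₀ ℕ.≤ M) (base : Monomials (+ i₀) (+ j₀ ℤ.- + M)) where

      Cell : ℤ → ℤ → Set (c ⊔ h)
      Cell k l = Monomials (affine N i₀ k) (affine M j₀ l)

      cell-pos-pos : ∀ m n → Cell (+ m) (+ n)
      cell-pos-pos m n r a b = [≈0]⊆H (InU0⇒[≈0] ((0≤affine N i₀ m , 0≤affine M j₀ n) ∷ []))

      cell-neg-neg : ∀ m n → Cell -[1+ m ] -[1+ n ]
      cell-neg-neg m n r a b = [≈0]⊆H (InU1⇒[≈0] ((affine≤0 m i₀≤N , affine≤0 n j₀≤M) ∷ []))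

      cell-base : Cell (+ 0) -[1+ 0 ]
      cell-base = ≡.subst₂ Monomials (≡.sym (affine-zero N i₀)) (≡.sym (affine-minus-one M j₀)) base

      step₁₀ : ∀ k l → Cell k l → Cell k (ℤ.suc l) → Cell (ℤ.suc k) (ℤ.suc l) → Cell (ℤ.suc k) l
      step₁₀ k l = corner₁₀ (affine-suc N i₀ k) (affine-suc M j₀ l)

      step₀₁ : ∀ k l → Cell k l → Cell (ℤ.suc k) l → Cell (ℤ.suc k) (ℤ.suc l) → Cell k (ℤ.suc l)
      step₀₁ k l = corner₀₁ (affine-suc N i₀ k) (affine-suc M j₀ l)

      cell-pos-neg : ∀ m n → Cell (+ m) -[1+ n ]
      cell-pos-neg zero    zero    = cell-base
      cell-pos-neg zero    (suc n) = step₁₀ -[1+ 0 ] -[1+ suc n ]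
        (cell-neg-neg 0 (suc n)) (cell-neg-neg 0 n) (cell-pos-neg 0 n)
      cell-pos-neg (suc m) zero    = step₁₀ (+ m) -[1+ 0 ]
        (cell-pos-neg m 0) (cell-pos-pos m 0) (cell-pos-pos (suc m) 0)
      cell-pos-neg (suc m) (suc n) = step₁₀ (+ m) -[1+ suc n ]
        (cell-pos-neg m (suc n)) (cell-pos-neg m n) (cell-pos-neg (suc m) n)

      cell-neg-pos : ∀ m n → Cell -[1+ m ] (+ n)
      cell-neg-pos zero    zero    = step₀₁ -[1+ 0 ] -[1+ 0 ]
        (cell-neg-neg 0 0) (cell-pos-neg 0 0) (cell-pos-pos 0 0)
      cell-neg-pos (suc m) zero    = step₀₁ -[1+ suc m ] -[1+ 0 ]
        (cell-neg-neg (suc m) 0) (cell-neg-neg m 0) (cell-neg-pos m 0)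
      cell-neg-pos zero    (suc n) = step₀₁ -[1+ 0 ] (+ n)
        (cell-neg-pos 0 n) (cell-pos-pos 0 n) (cell-pos-pos 0 (suc n))
      cell-neg-pos (suc m) (suc n) = step₀₁ -[1+ suc m ] (+ n)
        (cell-neg-pos (suc m) n) (cell-neg-pos m n) (cell-neg-pos m (suc n))

      sweep : ∀ k l → Cell k l
      sweep (+ m)    (+ n)    = cell-pos-pos m n
      sweep (+ m)    -[1+ n ] = cell-pos-neg m n
      sweep -[1+ m ] (+ n)    = cell-neg-pos m n
      sweep -[1+ m ] -[1+ n ] = cell-neg-neg m n

  module Vanishing = Corners [≈0]-isSubgroup (λ p≈0 → p≈0)
  module Multiples (g : Poly W) = Corners (∈A·-isSubgroup g) (λ {p} → [≈0]⇒∈A· {g} {p})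

  Coefficients : Set c
  Coefficients = Fin (N ℕ.∸ 1) → Fin (M ℕ.∸ 1) → Poly W

  infix 4 _∈A·gen
  _∈A·gen : Poly W → Set (c ⊔ ℓ)
  p ∈A·gen = Σ Coefficients λ α → (∀ i j → InA W (α i j)) × [ p ]≈[ genCombination W N M α ]

  open import Algebra.Properties.CommutativeMonoid.Sum P.commutativeMonoid
    using (sum; sum-cong-≋; sum-cong-≗; ∑-distrib-+; sum-replicate-zero)

  genTerms : Coefficients → Fin (N ℕ.∸ 1) → Fin (M ℕ.∸ 1) → Poly W
  genTerms α i j = α i j ⊗ₚ gen W N M i j

  ∑ᵢ : (Fin (N ℕ.∸ 1) → Poly W) → Poly W
  ∑ᵢ = sum

  ∑ⱼ : (Fin (M ℕ.∸ 1) → Poly W) → Poly W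
  ∑ⱼ = sum

  genCombination-sum : ∀ α → genCombination W N M α ≡ ∑ᵢ (λ i → ∑ⱼ (genTerms α i))
  genCombination-sum α =
    ≡.trans (concat-map-allFin (N ℕ.∸ 1) _)
            (sum-cong-≗ {N ℕ.∸ 1} (λ i → concat-map-allFin (M ℕ.∸ 1) (genTerms α i)))

  genCombination-++ : ∀ α β →
    genCombination W N M α ++ genCombination W N M β ≐ genCombination W N M (λ i j → α i j ++ β i j)
  genCombination-++ α β = begin
    genCombination W N M α ++ genCombination W N M β
      ≡⟨ ≡.cong₂ _++_ (genCombination-sum α) (genCombination-sum β) ⟩
    ∑ᵢ (λ i → ∑ⱼ (genTerms α i)) ++ ∑ᵢ (λ i → ∑ⱼ (genTerms β i))
      ≈⟨ ∑-distrib-+ (λ i → ∑ⱼ (genTerms α i)) (λ i → ∑ⱼ (genTerms β i)) ⟨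
    ∑ᵢ (λ i → ∑ⱼ (genTerms α i) ++ ∑ⱼ (genTerms β i))
      ≈⟨ sum-cong-≋ {N ℕ.∸ 1} (λ i → P.sym (∑-distrib-+ (genTerms α i) (genTerms β i))) ⟩
    ∑ᵢ (λ i → ∑ⱼ (λ j → genTerms α i j ++ genTerms β i j))
      ≡⟨ sum-cong-≗ {N ℕ.∸ 1} (λ i → sum-cong-≗ {M ℕ.∸ 1} (λ j → ⊗-distribʳ-++ (α i j) (β i j) (gen W N M i j))) ⟨
    ∑ᵢ (λ i → ∑ⱼ (genTerms (λ i j → α i j ++ β i j) i))
      ≡⟨ genCombination-sum (λ i j → α i j ++ β i j) ⟨
    genCombination W N M (λ i j → α i j ++ β i j) ∎

  genCombination-zero : genCombination W N M (λ _ _ → []) ≐ []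
  genCombination-zero = begin
    genCombination W N M (λ _ _ → []) ≡⟨ genCombination-sum (λ _ _ → []) ⟩
    ∑ᵢ (λ _ → ∑ⱼ (λ _ → []))          ≈⟨ sum-cong-≋ {N ℕ.∸ 1} (λ _ → sum-replicate-zero (M ℕ.∸ 1)) ⟩
    ∑ᵢ (λ _ → [])                     ≈⟨ sum-replicate-zero (N ℕ.∸ 1) ⟩
    []                                ∎

  single : Fin (N ℕ.∸ 1) → Fin (M ℕ.∸ 1) → Poly W → Coefficients
  single i₀ j₀ β i j = if does (i Fin.≟ i₀) ∧ does (j Fin.≟ j₀) then β else []

  single-diag : ∀ i₀ j₀ β → single i₀ j₀ β i₀ j₀ ≡ β
  single-diag i₀ j₀ β rewrite dec-true (i₀ Fin.≟ i₀) ≡.refl | dec-true (j₀ Fin.≟ j₀) ≡.refl = ≡.refl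

  single-off-row : ∀ {i₀ j₀ β i} j → i ≢ i₀ → single i₀ j₀ β i j ≡ []
  single-off-row {i₀} {i = i} _ i≢i₀ rewrite dec-false (i Fin.≟ i₀) i≢i₀ = ≡.refl

  single-off-col : ∀ {i₀ j₀ β} i {j} → j ≢ j₀ → single i₀ j₀ β i j ≡ []
  single-off-col {i₀} {j₀} i {j} j≢j₀ with does (i Fin.≟ i₀)
  ... | true  rewrite dec-false (j Fin.≟ j₀) j≢j₀ = ≡.refl
  ... | false = ≡.refl

  single-InA : ∀ i₀ j₀ {β} → InA W β → ∀ i j → InA W (single i₀ j₀ β i j)
  single-InA i₀ j₀ β∈A i j with does (i Fin.≟ i₀) ∧ does (j Fin.≟ j₀)
  ... | true  = β∈A
  ... | false = []

  genCombination-single : ∀ i₀ j₀ β → genCombination W N M (single i₀ j₀ β) ≐ β ⊗ₚ gen W N M i₀ j₀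
  genCombination-single i₀ j₀ β = begin
    genCombination W N M (single i₀ j₀ β) ≡⟨ genCombination-sum (single i₀ j₀ β) ⟩
    ∑ᵢ (λ i → ∑ⱼ (t i))                   ≈⟨ sum-cong-≋ {N ℕ.∸ 1} (λ i → sum-single P.commutativeMonoid (t i) j₀ (off-col i)) ⟩
    ∑ᵢ (λ i → t i j₀)                     ≈⟨ sum-single P.commutativeMonoid (λ i → t i j₀) i₀ off-row ⟩
    t i₀ j₀                               ≡⟨ ≡.cong (_⊗ₚ gen W N M i₀ j₀) (single-diag i₀ j₀ β) ⟩
    β ⊗ₚ gen W N M i₀ j₀                  ∎
    where
    t = genTerms (single i₀ j₀ β)

    off-col : ∀ i j → j ≢ j₀ → t i j ≐ []
    off-col i j j≢j₀ = ≡⇒≐ (≡.cong (_⊗ₚ gen W N M i j) (single-off-col i j≢j₀))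

    off-row : ∀ i → i ≢ i₀ → t i j₀ ≐ []
    off-row i i≢i₀ = ≡⇒≐ (≡.cong (_⊗ₚ gen W N M i j₀) (single-off-row j₀ i≢i₀))

  ∈A·gen-++ : ∀ {p q} → p ∈A·gen → q ∈A·gen → p ++ q ∈A·gen
  ∈A·gen-++ {p} {q} (α , α∈A , p≈) (β , β∈A , q≈) =
    (λ i j → α i j ++ β i j) , (λ i j → All.++⁺ (α∈A i j) (β∈A i j)) ,
    [≈]-resp {p ++ q} {q = genCombination W N M α ++ genCombination W N M β} P.refl (genCombination-++ α β)
             ([≈]-++ {p} {q} {genCombination W N M α} {genCombination W N M β} p≈ q≈)

  [≈0]⇒∈A·gen : ∀ {p} → [ p ]≈0 → p ∈A·gen
  [≈0]⇒∈A·gen {p} p≈0 = (λ _ _ → []) , (λ _ _ → []) ,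
    [≈]-resp {p} {q = []} P.refl (P.sym genCombination-zero) ([≈0]⇒[≈[]] {p} p≈0)

  ∈A·[gen]⇒∈A·gen : ∀ i₀ j₀ {p} → p ∈A·[ gen W N M i₀ j₀ ] → p ∈A·gen
  ∈A·[gen]⇒∈A·gen i₀ j₀ {p} (β , β∈A , p≈βg) = single i₀ j₀ β , single-InA i₀ j₀ β∈A ,
    [≈]-resp {p} {q = β ⊗ₚ gen W N M i₀ j₀} P.refl (P.sym (genCombination-single i₀ j₀ β)) p≈βg

  module _ {{_ : ℕ.NonZero N}} {{_ : ℕ.NonZero M}} where

    monomial∈A·gen : ∀ r a b x y → monomial r a b x y ∈A·gen
    monomial∈A·gen r a b x y =
      ≡.subst₂ (λ x y → monomial r a b x y ∈A·gen)
        (≡.sym (ℤ.a≡a%ℕn+[a/ℕn]*n x N)) (≡.sym (ℤ.a≡a%ℕn+[a/ℕn]*n y M))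
        (by-residues (x ℤ.%ℕ N) (x ℤ./ℕ N) (ℤ.n%ℕd<d x N) (y ℤ.%ℕ M) (y ℤ./ℕ M) (ℤ.n%ℕd<d y M))
      where
      mono : ℕ → ℤ → ℕ → ℤ → Poly W
      mono i k j l = monomial r a b (affine N i k) (affine M j l)

      by-residues : ∀ i k → i ℕ.< N → ∀ j l → j ℕ.< M → mono i k j l ∈A·gen
      by-residues zero k _ j l j<M =
        [≈0]⇒∈A·gen {mono 0 k j l} (Vanishing.Sweep.sweep ℕ.z≤n (ℕ.<⇒≤ j<M) base k l r a b)
        where
        base : Vanishing.Monomials (+ 0) (+ j ℤ.- + M)
        base _ _ _ = InU1⇒[≈0] ((ℤ.≤-refl , ℤ.i≤j⇒i-j≤0 (ℤ.+≤+ (ℕ.<⇒≤ j<M))) ∷ [])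
      by-residues (suc i) k i<N zero l _ =
        [≈0]⇒∈A·gen {mono (suc i) k 0 l}
          (≡.subst (λ y → [ monomial r a b (affine N (suc i) k) y ]≈0) (≡.sym (affine-residue-zero M l))
            (Vanishing.Sweep.sweep (ℕ.<⇒≤ i<N) ℕ.≤-refl base k (l ℤ.- + 1) r a b))
        where
        base : Vanishing.Monomials (+ suc i) (+ M ℤ.- + M)
        base _ _ _ = InU0⇒[≈0] ((ℤ.+≤+ ℕ.z≤n , ℤ.≤-reflexive (≡.sym (ℤ.+-inverseʳ (+ M)))) ∷ [])
      by-residues (suc i) k i<N (suc j) l j<M =
        ∈A·[gen]⇒∈A·gen i′ j′ {mono (suc i) k (suc j) l}
          (≡.subst (mono (suc i) k (suc j) l ∈A·[_]) (≡.sym gen≡)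
            (Multiples.Sweep.sweep _ (ℕ.<⇒≤ i<N) (ℕ.<⇒≤ j<M) (λ r a b → monomial∈A·[monoXY] r a b _ _) k l r a b))
        where
        i′ = Fin.fromℕ< (ℕ.∸-monoˡ-≤ 1 i<N)
        j′ = Fin.fromℕ< (ℕ.∸-monoˡ-≤ 1 j<M)
        gen≡ : gen W N M i′ j′ ≡ monoXY W (+ suc i) (+ suc j ℤ.- + M)
        gen≡ = ≡.cong₂ (λ i j → monoXY W (+ suc i) (+ suc j ℤ.- + M)) (Fin.toℕ-fromℕ< _) (Fin.toℕ-fromℕ< _)

    ∈A·gen-all : ∀ f → f ∈A·gen
    ∈A·gen-all []                   = [≈0]⇒∈A·gen {[]} [[]]≈0
    ∈A·gen-all (term r a b x y ∷ f) =
      ∈A·gen-++ {monomial r a b x y} {f} (monomial∈A·gen r a b x y) (∈A·gen-all f)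

open import Data.Nat using (_≤_; _∸_)
open import Data.Nat.LCM using (lcm)
open import Data.Integer using (_+_; _-_; _*_)

lemma3p2 : ∀ {c ℓ} (W : CommutativeRing c ℓ) (N M : ℕ) → 2 ≤ N → 2 ≤ M →
    NMInvertible W N M → HasPrimitiveRoot W (lcm N M) →
    ((f : Poly W) → Σ (Fin (N ∸ 1) → Fin (M ∸ 1) → Poly W) λ α →
        (∀ i j → InA W (α i j)) × H1Eq W N M f (genCombination W N M α))
    × ((i j : ℕ) → 1 ≤ i → i ≤ N ∸ 1 → 1 ≤ j → j ≤ M ∸ 1 → (k l : ℤ) →
        Σ (Poly W) λ α → InA W α ×
          H1Eq W N M (monoXY W (+ i + k * + N) (+ j + l * + M))
                     (_⊗_ W α (monoXY W (+ i) (+ j - + M))))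
lemma3p2 W N M 2≤N 2≤M _ _ = ∈A·gen-all , multiple
  where
  open Cohomology W N M
  instance
    N≢0 : ℕ.NonZero N
    N≢0 = ℕ.>-nonZero (ℕ.≤-trans (ℕ.s≤s ℕ.z≤n) 2≤N)
    M≢0 : ℕ.NonZero M
    M≢0 = ℕ.>-nonZero (ℕ.≤-trans (ℕ.s≤s ℕ.z≤n) 2≤M)

  multiple : (i j : ℕ) → 1 ≤ i → i ≤ N ∸ 1 → 1 ≤ j → j ≤ M ∸ 1 → (k l : ℤ) →
    monoXY W (+ i + k * + N) (+ j + l * + M) ∈A·[ monoXY W (+ i) (+ j - + M) ]
  multiple i j _ i≤N-1 _ j≤M-1 k l =
    Multiples.Sweep.sweep _ (ℕ.≤-trans i≤N-1 (ℕ.m∸n≤m N 1)) (ℕ.≤-trans j≤M-1 (ℕ.m∸n≤m M 1))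
      (λ r a b → monomial∈A·[monoXY] r a b _ _) k l (CommutativeRing.1# W) 0 0
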